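{- Let $P=\mathcal{Z}_4$ and $x\in P$. If $\mathcal{O}$ is a promotion orbit of $\mathrm{Inc}^q(P)$ that contains $1324$ then the average value of the antipodal sum statistic $\mathcal{A}_x$ on $\mathcal{O}$ equals $q+1$ if and only if $\mathcal{O}$ is balanced.
   Context: $\mathcal{Z}_4$ is the zig-zag poset $x_1\lessdot x_2\gtrdot x_3\lessdot x_4$, self-dual with order-reversing involution $\kappa$ exchanging $x_1\leftrightarrow x_4$, $x_2\leftrightarrow x_3$. $\mathrm{Inc}^q(P)$ is the set of increasing labelings $f:P\to[q]$ ($f(x)<f(y)$ whenever $x<y$). Promotion: replace labels $1$ by empty boxes; for $i=2,\dots,q$ slide boxes upward (a box at $x$ becomes $i$ if some $y\gtrdot x$ is labeled $i$, and that element becomes a box); replace boxes by $q+1$ and subtract $1$ from all labels. $\mathcal{A}_x(f)=f(x)+f(\kappa(x))$. An orbit contains $1324$ if some labeling in it has a left-to-right label word with a subsequence in the relative order $1324$. A labeling with labels $w\le x\le y\le z$ (weakly increasing order) is balanced if $x-w=z-y$ or $w-z+q=y-x$; balancedness is constant on promotion orbits. -}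

module Defs where

open import Data.Nat using (ℕ; zero; suc; _+_; _*_; _∸_; _≤_; _<_; _≡ᵇ_)
open import Data.Bool using (Bool; true; false; if_then_else_; _∨_; _∧_)
open import Data.Maybe using (Maybe; just; nothing)
open import Data.List using (List; []; _∷_; foldl; map; upTo)
open import Data.List.Relation.Binary.Permutation.Propositional using (_↭_)
open import Data.Product using (_×_; ∃-syntax)
open import Data.Sum using (_⊎_)
open import Relation.Binary.PropositionalEquality using (_≡_)

data El : Set where
  x1 x2 x3 x4 : El

elems : List El
elems = x1 ∷ x2 ∷ x3 ∷ x4 ∷ []

-- covers a b  =  true iff a ⋖ b (b covers a)
covers : El → El → Bool
covers x1 x2 = true
covers x3 x2 = true
covers x3 x4 = true
covers _  _  = false

κ : El → El
κ x1 = x4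
κ x2 = x3
κ x3 = x2
κ x4 = x1

-- a labeling P → ℕ, stored as the word f(x1) f(x2) f(x3) f(x4)
record Lab : Set where
  constructor lab
  field
    l1 l2 l3 l4 : ℕ

val : Lab → El → ℕ
val (lab a b c d) x1 = a
val (lab a b c d) x2 = b
val (lab a b c d) x3 = c
val (lab a b c d) x4 = d

Inc : ℕ → Lab → Set
Inc q f = (∀ e → 1 ≤ val f e × val f e ≤ q)
        × val f x1 < val f x2 × val f x3 < val f x2 × val f x3 < val f x4

-- Promotion (boxes = nothing)

State : Set
State = El → Maybe ℕ

isLab : ℕ → Maybe ℕ → Bool
isLab i (just v) = v ≡ᵇ i
isLab i nothing  = false

isBox : Maybe ℕ → Bool
isBox nothing  = true
isBox (just _) = false

anyL : (El → Bool) → Bool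
anyL p = p x1 ∨ p x2 ∨ p x3 ∨ p x4

-- one sliding step for label i: a box at e becomes i if some y ⋗ e is labelled i,
-- and an element labelled i covering a box becomes a box (simultaneously).
slide : ℕ → State → State
slide i s e with s e
... | nothing = if anyL (λ y → covers e y ∧ isLab i (s y)) then just i else nothing
... | just v  = if (v ≡ᵇ i) ∧ anyL (λ z → covers z e ∧ isBox (s z)) then nothing else just v

start : Lab → State
start f e = if val f e ≡ᵇ 1 then nothing else just (val f e)

-- slides for i = 2, …, q
slides : ℕ → State → State
slides q s = foldl (λ t i → slide i t) s (map (2 +_) (upTo (q ∸ 1)))

finish : ℕ → Maybe ℕ → ℕ
finish q nothing  = q
finish q (just v) = v ∸ 1

promotion : ℕ → Lab → Lab
promotion q f = lab (g x1) (g x2) (g x3) (g x4)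
  where
    s : State
    s = slides q (start f)
    g : El → ℕ
    g e = finish q (s e)

pro^ : ℕ → ℕ → Lab → Lab
pro^ q zero    f = f
pro^ q (suc k) f = promotion q (pro^ q k f)

OrbitSize : ℕ → Lab → ℕ → Set
OrbitSize q f p = 0 < p × pro^ q p f ≡ f × (∀ k → 0 < k → k < p → pro^ q k f ≡ f → Data.Empty.⊥)
  where import Data.Empty

A : El → Lab → ℕ
A x f = val f x + val f (κ x)

sumTo : ℕ → (ℕ → ℕ) → ℕ
sumTo zero    g = 0
sumTo (suc p) g = sumTo p g + g p

-- the word f(x1)f(x2)f(x3)f(x4) (length 4) has a subsequence in relative order 1324,
-- i.e. (the whole word) w1 < w3 < w2 < w4
Has1324 : Lab → Set
Has1324 (lab a b c d) = a < c × c < b × b < d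

OrbitContains1324 : ℕ → Lab → Set
OrbitContains1324 q f = ∃[ k ] Has1324 (pro^ q k f)

-- balanced: sorted labels w ≤ x ≤ y ≤ z with x - w = z - y or w - z + q = y - x
-- (written additively: x + y = z + w, resp. w + q + x = y + z)
Balanced : ℕ → Lab → Set
Balanced q (lab a b c d) =
  ∃[ w ] ∃[ x ] ∃[ y ] ∃[ z ]
    ((w ∷ x ∷ y ∷ z ∷ []) ↭ (a ∷ b ∷ c ∷ d ∷ []))
    × w ≤ x × x ≤ y × y ≤ z
    × (x + y ≡ z + w ⊎ w + q + x ≡ y + z)

OrbitBalanced : ℕ → Lab → Set
OrbitBalanced q f = ∀ k → Balanced q (pro^ q k f)

{-# OPTIONS --safe #-}
-- Write the labels of a labeling in pattern 1324 or 2413 as s < s + a < s + a + b < s + a + b + c.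
-- Promotion lowers every label by one until the smallest label is 1; then that label wraps to q,
-- the pattern switches between 1324 and 2413, and the cyclic gaps of the four labels modulo q
-- rotate. So an orbit containing 1324 returns after q steps, made of four phases whose lengths
-- are the cyclic gaps u, v, w, G. Adding up the phases gives Σ A_x = q (q + 1) ± (u − w)(v − G),
-- and a labeling of the orbit is balanced exactly when u = w or v = G.
module Submission where

open import Defs
open import Data.Bool using (true; false; if_then_else_)
open import Data.Bool.Properties using (∧-zeroʳ; ∨-identityʳ)
open import Data.Empty using (⊥-elim)
open import Data.List using ([]; _∷_; _∷ʳ_; foldl; map; upTo)
open import Data.List.Properties using (upTo-∷ʳ; map-++; foldl-∷ʳ)
open import Data.List.Relation.Binary.Permutation.Propositional
  using (_↭_; ↭-refl; ↭-sym; ↭-trans; ↭-swap; ↭-prep; ↭⇒↭ₛ)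
import Data.List.Relation.Binary.Pointwise as Pointwise
import Data.List.Relation.Unary.Linked as Linked
open import Data.List.Relation.Unary.Sorted.TotalOrder.Properties using (↗↭↗⇒≋)
open import Data.Maybe using (Maybe; just; nothing)
open import Data.Nat
open import Data.Nat.DivMod using (m≡m%n+[m/n]*n; m%n<n)
open import Data.Nat.Divisibility using (_∣_; divides; m%n≡0⇒n∣m)
open import Data.Nat.Properties
open import Data.Nat.Tactic.RingSolver
open import Data.Product using (_×_; _,_; proj₁; proj₂; ∃)
open import Data.Sum using (_⊎_; inj₁; inj₂)
open import Data.Sum.Function.Propositional using (_⊎-⇔_)
open import Data.Unit using (⊤; tt)
open import Function.Bundles using (_⇔_; mk⇔; Equivalence)
open import Function.Construct.Identity using (⇔-id)
import Function.Properties.Equivalence as ⇔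
open import Level using (0ℓ)
open import Relation.Binary.PropositionalEquality
import Relation.Binary.Reasoning.Setoid as SetoidReasoning

module ⇔-Reasoning = SetoidReasoning (⇔.⇔-setoid 0ℓ)

-- Sums of periodic sequences

Periodic : ℕ → (ℕ → ℕ) → Set
Periodic p g = ∀ k → g (p + k) ≡ g k

sumTo-cong : ∀ n {g h : ℕ → ℕ} → (∀ k → g k ≡ h k) → sumTo n g ≡ sumTo n h
sumTo-cong zero    g≗h = refl
sumTo-cong (suc n) g≗h = cong₂ _+_ (sumTo-cong n g≗h) (g≗h n)

sumTo-+ : ∀ m n g → sumTo (m + n) g ≡ sumTo m g + sumTo n (λ k → g (m + k))
sumTo-+ m zero    g = trans (cong (λ n → sumTo n g) (+-identityʳ m)) (sym (+-identityʳ (sumTo m g)))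
sumTo-+ m (suc n) g = begin
  sumTo (m + suc n) g                                    ≡⟨ cong (λ k → sumTo k g) (+-suc m n) ⟩
  sumTo (m + n) g + g (m + n)                            ≡⟨ cong (_+ g (m + n)) (sumTo-+ m n g) ⟩
  sumTo m g + sumTo n (λ k → g (m + k)) + g (m + n)      ≡⟨ +-assoc (sumTo m g) _ _ ⟩
  sumTo m g + (sumTo n (λ k → g (m + k)) + g (m + n))    ∎
  where open ≡-Reasoning

sumTo-periodic-* : ∀ {p g} → Periodic p g → ∀ m → sumTo (m * p) g ≡ m * sumTo p g
sumTo-periodic-* {p} {g} per zero    = refl
sumTo-periodic-* {p} {g} per (suc m) = begin
  sumTo (p + m * p) g                          ≡⟨ sumTo-+ p (m * p) g ⟩
  sumTo p g + sumTo (m * p) (λ k → g (p + k))  ≡⟨ cong (sumTo p g +_) (sumTo-cong (m * p) per) ⟩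
  sumTo p g + sumTo (m * p) g                  ≡⟨ cong (sumTo p g +_) (sumTo-periodic-* per m) ⟩
  sumTo p g + m * sumTo p g                    ∎
  where open ≡-Reasoning

-- Both sides plus sumTo s g equal sumTo (s + p) g.
sumTo-periodic-shift : ∀ {p g} → Periodic p g → ∀ s → sumTo p (λ k → g (s + k)) ≡ sumTo p g
sumTo-periodic-shift {p} {g} per s = +-cancelˡ-≡ (sumTo s g) _ _ (begin
  sumTo s g + sumTo p (λ k → g (s + k))  ≡⟨ sumTo-+ s p g ⟨
  sumTo (s + p) g                        ≡⟨ cong (λ n → sumTo n g) (+-comm s p) ⟩
  sumTo (p + s) g                        ≡⟨ sumTo-+ p s g ⟩
  sumTo p g + sumTo s (λ k → g (p + k))  ≡⟨ cong (sumTo p g +_) (sumTo-cong s per) ⟩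
  sumTo p g + sumTo s g                  ≡⟨ +-comm (sumTo p g) _ ⟩
  sumTo s g + sumTo p g                  ∎)
  where open ≡-Reasoning

*-cancel-⇔ : ∀ m {x y} → (x ≡ y) ⇔ (suc m * x ≡ suc m * y)
*-cancel-⇔ m = mk⇔ (cong (suc m *_)) (*-cancelˡ-≡ _ _ (suc m))

sumTo-periodic-average : ∀ {p g n} c → Periodic p g → (∃ λ m → n ≡ suc m * p) →
  (sumTo p g ≡ c * p) ⇔ (sumTo n g ≡ c * n)
sumTo-periodic-average {p} {g} c per (m , refl) =
  subst₂ (λ S T → (sumTo p g ≡ c * p) ⇔ (S ≡ T)) (sym (sumTo-periodic-* per (suc m))) (sym scaled) (*-cancel-⇔ m)
  where
  scaled : c * (suc m * p) ≡ suc m * (c * p)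
  scaled = solve (c ∷ m ∷ p ∷ [])

-- Iterated promotion and sums along orbits

module _ (q : ℕ) where

  pro^-suc : ∀ n h → pro^ q (suc n) h ≡ pro^ q n (promotion q h)
  pro^-suc zero    h = refl
  pro^-suc (suc n) h = cong (promotion q) (pro^-suc n h)

  pro^-+ : ∀ m n h → pro^ q (m + n) h ≡ pro^ q m (pro^ q n h)
  pro^-+ zero    n h = refl
  pro^-+ (suc m) n h = cong (promotion q) (pro^-+ m n h)

  pro^-+′ : ∀ m n h → pro^ q (m + n) h ≡ pro^ q n (pro^ q m h)
  pro^-+′ m n h = trans (cong (λ k → pro^ q k h) (+-comm m n)) (pro^-+ n m h)

  pro^-comm : ∀ m n h → pro^ q m (pro^ q n h) ≡ pro^ q n (pro^ q m h)
  pro^-comm m n h = trans (sym (pro^-+ m n h)) (pro^-+′ m n h)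

  pro^-* : ∀ {p h} → pro^ q p h ≡ h → ∀ m → pro^ q (m * p) h ≡ h
  pro^-* {p} {h} fixed zero    = refl
  pro^-* {p} {h} fixed (suc m) = begin
    pro^ q (p + m * p) h         ≡⟨ pro^-+ p (m * p) h ⟩
    pro^ q p (pro^ q (m * p) h)  ≡⟨ cong (pro^ q p) (pro^-* fixed m) ⟩
    pro^ q p h                   ≡⟨ fixed ⟩
    h                            ∎
    where open ≡-Reasoning

  pro^-fixed-along : ∀ {n r h f} → pro^ q n h ≡ h → pro^ q r h ≡ f → pro^ q n f ≡ f
  pro^-fixed-along {n} {r} {h} fixed refl = begin
    pro^ q n (pro^ q r h)  ≡⟨ pro^-comm n r h ⟩
    pro^ q r (pro^ q n h)  ≡⟨ cong (pro^ q r) fixed ⟩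
    pro^ q r h             ∎
    where open ≡-Reasoning

  -- j * p more steps after the j-th one complete j full periods of length suc p.
  pro^-return : ∀ {p h} → pro^ q (suc p) h ≡ h → ∀ j → pro^ q (j * p) (pro^ q j h) ≡ h
  pro^-return {p} {h} fixed j = begin
    pro^ q (j * p) (pro^ q j h)  ≡⟨ pro^-+ (j * p) j h ⟨
    pro^ q (j * p + j) h         ≡⟨ cong (λ n → pro^ q n h) (trans (+-comm (j * p) j) (sym (*-suc j p))) ⟩
    pro^ q (j * suc p) h         ≡⟨ pro^-* fixed j ⟩
    h                            ∎
    where open ≡-Reasoning

  OrbitSize-∣ : ∀ {f p n} → OrbitSize q f p → pro^ q n f ≡ f → p ∣ n
  OrbitSize-∣ {f} {suc p} {n} (_ , period , minimal) fixed =
    m%n≡0⇒n∣m n (suc p) (remainder-zero (n % suc p) (m%n<n n (suc p)) remainder-fixed)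
    where
    open ≡-Reasoning
    remainder-fixed : pro^ q (n % suc p) f ≡ f
    remainder-fixed = begin
      pro^ q (n % suc p) f                                 ≡⟨ cong (pro^ q (n % suc p)) (pro^-* period (n / suc p)) ⟨
      pro^ q (n % suc p) (pro^ q (n / suc p * suc p) f)    ≡⟨ pro^-+ (n % suc p) _ f ⟨
      pro^ q (n % suc p + n / suc p * suc p) f             ≡⟨ cong (λ k → pro^ q k f) (m≡m%n+[m/n]*n n (suc p)) ⟨
      pro^ q n f                                           ≡⟨ fixed ⟩
      f                                                    ∎
    remainder-zero : ∀ r → r < suc p → pro^ q r f ≡ f → r ≡ 0
    remainder-zero zero    _   _     = refl
    remainder-zero (suc r) r<p fixedʳ = ⊥-elim (minimal (suc r) (s≤s z≤n) r<p fixedʳ)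

  orbitSum : El → ℕ → Lab → ℕ
  orbitSum x n h = sumTo n (λ k → A x (pro^ q k h))

  orbitSum-+ : ∀ x m n h → orbitSum x (m + n) h ≡ orbitSum x m h + orbitSum x n (pro^ q m h)
  orbitSum-+ x m n h = trans (sumTo-+ m n _) (cong (orbitSum x m h +_) (sumTo-cong n (λ k → cong (A x) (pro^-+′ m k h))))

  A-periodic : ∀ {p h} x → pro^ q p h ≡ h → Periodic p (λ k → A x (pro^ q k h))
  A-periodic {p} {h} x fixed k = cong (A x) (trans (pro^-+′ p k h) (cong (pro^ q k) fixed))

  orbitSum-rotate : ∀ {n h} x j → pro^ q n h ≡ h → orbitSum x n (pro^ q j h) ≡ orbitSum x n h
  orbitSum-rotate {n} {h} x j fixed = begin
    sumTo n (λ k → A x (pro^ q k (pro^ q j h)))  ≡⟨ sumTo-cong n (λ k → cong (A x) (pro^-+′ j k h)) ⟨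
    sumTo n (λ k → A x (pro^ q (j + k) h))       ≡⟨ sumTo-periodic-shift (A-periodic x fixed) j ⟩
    sumTo n (λ k → A x (pro^ q k h))             ∎
    where open ≡-Reasoning

record Segment (q : ℕ) (x : El) (h : Lab) (n S : ℕ) (h′ : Lab) : Set where
  field
    lands : pro^ q n h ≡ h′
    sums  : orbitSum q x n h ≡ S

infixl 5 _⨾_
_⨾_ : ∀ {q x h m S h′ n T h″} → Segment q x h m S h′ → Segment q x h′ n T h″ → Segment q x h (m + n) (S + T) h″
_⨾_ {q} {x} {h} {m} {S} {h′} {n} {T} {h″} first second = record
  { lands = begin
      pro^ q (m + n) h        ≡⟨ pro^-+′ q m n h ⟩
      pro^ q n (pro^ q m h)   ≡⟨ cong (pro^ q n) (Segment.lands first) ⟩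
      pro^ q n h′             ≡⟨ Segment.lands second ⟩
      h″                      ∎
  ; sums = begin
      orbitSum q x (m + n) h                          ≡⟨ orbitSum-+ q x m n h ⟩
      orbitSum q x m h + orbitSum q x n (pro^ q m h)  ≡⟨ cong₂ _+_ (Segment.sums first) (cong (orbitSum q x n) (Segment.lands first)) ⟩
      S + orbitSum q x n h′                           ≡⟨ cong (S +_) (Segment.sums second) ⟩
      S + T                                           ∎
  }
  where open ≡-Reasoning

-- Promotion computed by sliding

≡ᵇ-refl : ∀ n → (n ≡ᵇ n) ≡ true
≡ᵇ-refl zero    = refl
≡ᵇ-refl (suc n) = ≡ᵇ-refl n

>⇒≡ᵇ-false : ∀ {m n} → m < n → (n ≡ᵇ m) ≡ false
>⇒≡ᵇ-false {zero}  {suc n} _         = refl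
>⇒≡ᵇ-false {suc m} {suc n} (s≤s m<n) = >⇒≡ᵇ-false m<n

slide-cong : ∀ i {s t} → s ≗ t → slide i s ≗ slide i t
slide-cong i {s} {t} s≗t e with s e | t e | s≗t e
... | nothing | _ | refl rewrite s≗t x1 | s≗t x2 | s≗t x3 | s≗t x4 = refl
... | just v  | _ | refl rewrite s≗t x1 | s≗t x3 = refl

-- slides q = slidesUpTo (q ∸ 1): the slides for the labels 2, …, n + 1.
slidesUpTo : ℕ → State → State
slidesUpTo n s = foldl (λ t i → slide i t) s (map (2 +_) (upTo n))

slidesUpTo-suc : ∀ n s → slidesUpTo (suc n) s ≡ slide (2 + n) (slidesUpTo n s)
slidesUpTo-suc n s = begin
  foldl step s (map (2 +_) (upTo (suc n)))         ≡⟨ cong (λ xs → foldl step s (map (2 +_) xs)) (upTo-∷ʳ n) ⟨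
  foldl step s (map (2 +_) (upTo n ∷ʳ n))          ≡⟨ cong (foldl step s) (map-++ (2 +_) (upTo n) (n ∷ [])) ⟩
  foldl step s (map (2 +_) (upTo n) ∷ʳ (2 + n))    ≡⟨ foldl-∷ʳ step s (2 + n) (map (2 +_) (upTo n)) ⟩
  slide (2 + n) (slidesUpTo n s)                   ∎
  where
  open ≡-Reasoning
  step : State → ℕ → State
  step t i = slide i t

slidesUpTo-cong : ∀ n {s t} → s ≗ t → slidesUpTo n s ≗ slidesUpTo n t
slidesUpTo-cong zero    s≗t e = s≗t e
slidesUpTo-cong (suc n) {s} {t} s≗t e
  rewrite slidesUpTo-suc n s | slidesUpTo-suc n t = slide-cong (2 + n) (slidesUpTo-cong n s≗t) e

slidesUpTo-stable : ∀ n {s} → (∀ i → i < 2 + n → slide i s ≗ s) → slidesUpTo n s ≗ s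
slidesUpTo-stable zero    stable e = refl
slidesUpTo-stable (suc n) {s} stable e rewrite slidesUpTo-suc n s =
  trans (slide-cong (2 + n) (slidesUpTo-stable n (λ i i<2+n → stable i (m<n⇒m<1+n i<2+n))) e)
        (stable (2 + n) ≤-refl e)

slidesUpTo-jump : ∀ n {j s t} → j < n → (∀ i → i < 2 + j → slide i s ≗ s) → slide (2 + j) s ≗ t →
                  (∀ i → slide i t ≗ t) → slidesUpTo n s ≗ t
slidesUpTo-jump (suc n) {j} {s} j<1+n before jump after e rewrite slidesUpTo-suc n s
  with m<1+n⇒m<n∨m≡n j<1+n
... | inj₁ j<n  = trans (slide-cong (2 + n) (slidesUpTo-jump n j<n before jump after) e) (after (2 + n) e)
... | inj₂ refl = trans (slide-cong (2 + j) (slidesUpTo-stable j before) e) (jump e)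

state : Maybe ℕ → Maybe ℕ → Maybe ℕ → Maybe ℕ → State
state m₁ m₂ m₃ m₄ x1 = m₁
state m₁ m₂ m₃ m₄ x2 = m₂
state m₁ m₂ m₃ m₄ x3 = m₃
state m₁ m₂ m₃ m₄ x4 = m₄

initial : ℕ → Maybe ℕ
initial v = if v ≡ᵇ 1 then nothing else just v

lab-cong : ∀ {a b c d a′ b′ c′ d′} → a ≡ a′ → b ≡ b′ → c ≡ c′ → d ≡ d′ → lab a b c d ≡ lab a′ b′ c′ d′
lab-cong refl refl refl refl = refl

start-lab : ∀ a b c d → start (lab a b c d) ≗ state (initial a) (initial b) (initial c) (initial d)
start-lab a b c d x1 = refl
start-lab a b c d x2 = refl
start-lab a b c d x3 = refl
start-lab a b c d x4 = refl

promotion-via : ∀ q a b c d {t} →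
  slidesUpTo (q ∸ 1) (state (initial a) (initial b) (initial c) (initial d)) ≗ t →
  promotion q (lab a b c d) ≡ lab (finish q (t x1)) (finish q (t x2)) (finish q (t x3)) (finish q (t x4))
promotion-via q a b c d {t} slid = lab-cong (finished x1) (finished x2) (finished x3) (finished x4)
  where
  finished : ∀ e → finish q (slides q (start (lab a b c d)) e) ≡ finish q (t e)
  finished e = cong (finish q) (trans (slidesUpTo-cong (q ∸ 1) (start-lab a b c d) e) (slid e))

promotion-decrement : ∀ q a b c d →
  promotion q (lab (2 + a) (2 + b) (2 + c) (2 + d)) ≡ lab (1 + a) (1 + b) (1 + c) (1 + d)
promotion-decrement q a b c d = promotion-via q _ _ _ _ (slidesUpTo-stable (q ∸ 1) (λ i _ → unmoved i))
  where
  unmoved : ∀ i → slide i (state (just (2 + a)) (just (2 + b)) (just (2 + c)) (just (2 + d)))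
                ≗ state (just (2 + a)) (just (2 + b)) (just (2 + c)) (just (2 + d))
  unmoved i x1 rewrite ∧-zeroʳ (2 + a ≡ᵇ i) = refl
  unmoved i x2 rewrite ∧-zeroʳ (2 + b ≡ᵇ i) = refl
  unmoved i x3 rewrite ∧-zeroʳ (2 + c ≡ᵇ i) = refl
  unmoved i x4 rewrite ∧-zeroʳ (2 + d ≡ᵇ i) = refl

-- The box at x1 waits until the label 2 + b of x2 slides down into it.
promotion-wrap-x1 : ∀ q b c d → 2 + b ≤ q →
  promotion q (lab 1 (2 + b) (2 + c) (2 + d)) ≡ lab (1 + b) q (1 + c) (1 + d)
promotion-wrap-x1 q b c d 2+b≤q =
  promotion-via q _ _ _ _ (slidesUpTo-jump (q ∸ 1) (∸-monoˡ-≤ 1 2+b≤q) before jump after)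
  where
  s t : State
  s = state nothing (just (2 + b)) (just (2 + c)) (just (2 + d))
  t = state (just (2 + b)) nothing (just (2 + c)) (just (2 + d))
  before : ∀ i → i < 2 + b → slide i s ≗ s
  before i i<B x1 rewrite ∨-identityʳ (2 + b ≡ᵇ i) | >⇒≡ᵇ-false i<B = refl
  before i i<B x2 rewrite >⇒≡ᵇ-false i<B = refl
  before i i<B x3 rewrite ∧-zeroʳ (2 + c ≡ᵇ i) = refl
  before i i<B x4 rewrite ∧-zeroʳ (2 + d ≡ᵇ i) = refl
  jump : slide (2 + b) s ≗ t
  jump x1 rewrite ∨-identityʳ (2 + b ≡ᵇ 2 + b) | ≡ᵇ-refl b = refl
  jump x2 rewrite ≡ᵇ-refl b = refl
  jump x3 rewrite ∧-zeroʳ (2 + c ≡ᵇ 2 + b) = refl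
  jump x4 rewrite ∧-zeroʳ (2 + d ≡ᵇ 2 + b) = refl
  after : ∀ i → slide i t ≗ t
  after i x1 rewrite ∧-zeroʳ (2 + b ≡ᵇ i) = refl
  after i x2 = refl
  after i x3 rewrite ∧-zeroʳ (2 + c ≡ᵇ i) = refl
  after i x4 rewrite ∧-zeroʳ (2 + d ≡ᵇ i) = refl

-- The box at x3 is filled by the smaller of its two covers, here x4 since d < b.
promotion-wrap-x3 : ∀ q a b d → d < b → 2 + d ≤ q →
  promotion q (lab (2 + a) (2 + b) 1 (2 + d)) ≡ lab (1 + a) (1 + b) (1 + d) q
promotion-wrap-x3 q a b d d<b 2+d≤q =
  promotion-via q _ _ _ _ (slidesUpTo-jump (q ∸ 1) (∸-monoˡ-≤ 1 2+d≤q) before jump after)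
  where
  D<B : 2 + d < 2 + b
  D<B = s≤s (s≤s d<b)
  s t : State
  s = state (just (2 + a)) (just (2 + b)) nothing (just (2 + d))
  t = state (just (2 + a)) (just (2 + b)) (just (2 + d)) nothing
  before : ∀ i → i < 2 + d → slide i s ≗ s
  before i i<D x1 rewrite ∧-zeroʳ (2 + a ≡ᵇ i) = refl
  before i i<D x2 rewrite >⇒≡ᵇ-false (<-trans i<D D<B) = refl
  before i i<D x3 rewrite >⇒≡ᵇ-false (<-trans i<D D<B) | >⇒≡ᵇ-false i<D = refl
  before i i<D x4 rewrite >⇒≡ᵇ-false i<D = refl
  jump : slide (2 + d) s ≗ t
  jump x1 rewrite ∧-zeroʳ (2 + a ≡ᵇ 2 + d) = refl
  jump x2 rewrite >⇒≡ᵇ-false D<B = refl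
  jump x3 rewrite >⇒≡ᵇ-false D<B | ≡ᵇ-refl d = refl
  jump x4 rewrite ≡ᵇ-refl d = refl
  after : ∀ i → slide i t ≗ t
  after i x1 rewrite ∧-zeroʳ (2 + a ≡ᵇ i) = refl
  after i x2 rewrite ∧-zeroʳ (2 + b ≡ᵇ i) = refl
  after i x3 rewrite ∧-zeroʳ (2 + d ≡ᵇ i) = refl
  after i x4 = refl

Bounded : ℕ → Lab → Set
Bounded q h = ∀ e → 1 ≤ val h e × val h e ≤ q

-- A slot during sliding is a box or holds a label that will be decremented into [1, q].
SlotBounded : ℕ → Maybe ℕ → Set
SlotBounded q nothing  = ⊤
SlotBounded q (just v) = 2 ≤ v × v ≤ q

if-SlotBounded : ∀ {q} b {m n} → SlotBounded q m → SlotBounded q n → SlotBounded q (if b then m else n)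
if-SlotBounded true  bm bn = bm
if-SlotBounded false bm bn = bn

slide-bounded : ∀ {q i s} → 2 ≤ i → i ≤ q → (∀ e → SlotBounded q (s e)) → ∀ e → SlotBounded q (slide i s e)
slide-bounded {q} {i} {s} 2≤i i≤q bounded e with s e | bounded e
... | nothing | _  = if-SlotBounded _ (2≤i , i≤q) tt
... | just v  | bv = if-SlotBounded _ tt bv

slidesUpTo-bounded : ∀ {q} n {s} → n < q → (∀ e → SlotBounded q (s e)) → ∀ e → SlotBounded q (slidesUpTo n s e)
slidesUpTo-bounded zero    n<q bounded = bounded
slidesUpTo-bounded (suc n) {s} n<q bounded rewrite slidesUpTo-suc n s =
  slide-bounded (s≤s (s≤s z≤n)) n<q (slidesUpTo-bounded n (<-trans (n<1+n n) n<q) bounded)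

initial-bounded : ∀ {q v} → 1 ≤ v → v ≤ q → SlotBounded q (initial v)
initial-bounded {v = 1}           _ _   = tt
initial-bounded {v = suc (suc v)} _ v≤q = s≤s (s≤s z≤n) , v≤q

finish-bounded : ∀ {q} m → 1 ≤ q → SlotBounded q m → 1 ≤ finish q m × finish q m ≤ q
finish-bounded nothing              1≤q _            = 1≤q , ≤-refl
finish-bounded (just (suc (suc v))) 1≤q (_ , 2+v≤q) = s≤s z≤n , ≤-trans (n≤1+n (suc v)) 2+v≤q
finish-bounded (just 1)             1≤q (s≤s () , _)

promotion-bounded : ∀ {q h} → Bounded q h → Bounded q (promotion q h)
promotion-bounded {q} {h} bounded = λ { x1 → finished x1 ; x2 → finished x2 ; x3 → finished x3 ; x4 → finished x4 }
  where
  1≤q : 1 ≤ q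
  1≤q = ≤-trans (proj₁ (bounded x1)) (proj₂ (bounded x1))
  finished : ∀ e → 1 ≤ finish q (slides q (start h) e) × finish q (slides q (start h) e) ≤ q
  finished e = finish-bounded _ 1≤q
    (slidesUpTo-bounded (q ∸ 1) (∸-monoʳ-< {o = 0} z<s 1≤q)
      (λ e → initial-bounded (proj₁ (bounded e)) (proj₂ (bounded e))) e)

pro^-bounded : ∀ {q h} → Bounded q h → ∀ k → Bounded q (pro^ q k h)
pro^-bounded bounded zero    = bounded
pro^-bounded bounded (suc k) = promotion-bounded (pro^-bounded bounded k)

-- Labelings in the patterns 1324 and 2413

data Pattern : Set where
  p1324 p2413 : Pattern

opposite : Pattern → Pattern
opposite p1324 = p2413
opposite p2413 = p1324

opposite-involutive : ∀ π → opposite (opposite π) ≡ π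
opposite-involutive p1324 = refl
opposite-involutive p2413 = refl

-- The labels s ≤ s + a ≤ s + a + b ≤ s + a + b + c in the relative order π.
-- Once the top label is q, the cyclic gaps of the labels modulo q are a, b, c and s.
shaped : Pattern → (s a b c : ℕ) → Lab
shaped p1324 s a b c = lab s (s + a + b) (s + a) (s + a + b + c)
shaped p2413 s a b c = lab (s + a) (s + a + b + c) s (s + a + b)

promotion-shaped-suc : ∀ q π s a b c → promotion q (shaped π (2 + s) a b c) ≡ shaped π (1 + s) a b c
promotion-shaped-suc q p1324 s a b c = promotion-decrement q _ _ _ _
promotion-shaped-suc q p2413 s a b c = promotion-decrement q _ _ _ _

promotion-shaped-wrap : ∀ π a b c d →
  promotion (suc a + b + suc c + d) (shaped π 1 (suc a) b (suc c)) ≡ shaped (opposite π) (suc a) b (suc c) d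
promotion-shaped-wrap π a b c d = wrap π
  where
  below-top : 2 + (a + b) ≤ suc a + b + suc c + d
  below-top = s≤s (≤-trans (m<m+n (a + b) z<s) (m≤m+n (a + b + suc c) d))
  wrap : ∀ π → promotion (suc a + b + suc c + d) (shaped π 1 (suc a) b (suc c)) ≡ shaped (opposite π) (suc a) b (suc c) d
  wrap p1324 = promotion-wrap-x1 _ (a + b) a (a + b + suc c) below-top
  wrap p2413 = promotion-wrap-x3 _ a (a + b + suc c) (a + b) (m<m+n (a + b) z<s) below-top

pro^-shaped-descend : ∀ q π n s a b c → pro^ q n (shaped π (suc n + s) a b c) ≡ shaped π (suc s) a b c
pro^-shaped-descend q π zero    s a b c = refl
pro^-shaped-descend q π (suc n) s a b c = begin
  pro^ q (suc n) (shaped π (2 + (n + s)) a b c)        ≡⟨ pro^-suc q n _ ⟩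
  pro^ q n (promotion q (shaped π (2 + (n + s)) a b c)) ≡⟨ cong (pro^ q n) (promotion-shaped-suc q π (n + s) a b c) ⟩
  pro^ q n (shaped π (suc n + s) a b c)                 ≡⟨ pro^-shaped-descend q π n s a b c ⟩
  shaped π (suc s) a b c                                ∎
  where open ≡-Reasoning

succ : Lab → Lab
succ (lab a b c d) = lab (suc a) (suc b) (suc c) (suc d)

shaped-suc : ∀ π s a b c → shaped π (suc s) a b c ≡ succ (shaped π s a b c)
shaped-suc p1324 s a b c = refl
shaped-suc p2413 s a b c = refl

A-succ : ∀ x h → A x (succ h) ≡ 2 + A x h
A-succ x1 (lab a b c d) = cong suc (+-suc a d)
A-succ x2 (lab a b c d) = cong suc (+-suc b c)
A-succ x3 (lab a b c d) = cong suc (+-suc c b)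
A-succ x4 (lab a b c d) = cong suc (+-suc d a)

A-shaped : ∀ x π s a b c → A x (shaped π s a b c) ≡ 2 * s + A x (shaped π 0 a b c)
A-shaped x π zero    a b c = refl
A-shaped x π (suc s) a b c = begin
  A x (shaped π (suc s) a b c)              ≡⟨ cong (A x) (shaped-suc π s a b c) ⟩
  A x (succ (shaped π s a b c))             ≡⟨ A-succ x _ ⟩
  2 + A x (shaped π s a b c)                ≡⟨ cong (2 +_) (A-shaped x π s a b c) ⟩
  2 + (2 * s + A x (shaped π 0 a b c))      ≡⟨ +-assoc 2 (2 * s) _ ⟨
  2 + 2 * s + A x (shaped π 0 a b c)        ≡⟨ cong (_+ A x (shaped π 0 a b c)) (*-suc 2 s) ⟨
  2 * suc s + A x (shaped π 0 a b c)        ∎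
  where open ≡-Reasoning

-- While the bottom label stays above 1, every step lowers all labels by one.
orbitSum-shaped : ∀ q x π n a b c → orbitSum q x n (shaped π n a b c) ≡ n * suc n + n * A x (shaped π 0 a b c)
orbitSum-shaped q x π zero    a b c = refl
orbitSum-shaped q x π (suc n) a b c = begin
  orbitSum q x (1 + n) (shaped π (suc n) a b c)                                 ≡⟨ orbitSum-+ q x 1 n _ ⟩
  A x (shaped π (suc n) a b c) + orbitSum q x n (promotion q (shaped π (suc n) a b c))
                                                                                ≡⟨ cong₂ _+_ (A-shaped x π (suc n) a b c) (rest n) ⟩
  2 * suc n + t + (n * suc n + n * t)                                           ≡⟨ arithmetic n t ⟩
  suc n * suc (suc n) + suc n * t                                               ∎
  where
  open ≡-Reasoning
  t : ℕ
  t = A x (shaped π 0 a b c)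
  rest : ∀ n → orbitSum q x n (promotion q (shaped π (suc n) a b c)) ≡ n * suc n + n * t
  rest zero    = refl
  rest (suc m) = trans (cong (orbitSum q x (suc m)) (promotion-shaped-suc q π m a b c)) (orbitSum-shaped q x π (suc m) a b c)
  arithmetic : ∀ n t → 2 * suc n + t + (n * suc n + n * t) ≡ suc n * suc (suc n) + suc n * t
  arithmetic = solve-∀

phaseSum : El → Pattern → (s a b c : ℕ) → ℕ
phaseSum x π s a b c = s * suc s + s * A x (shaped π 0 a b c)

pro^-shaped-wrap : ∀ q π s a b c d → q ≡ suc a + b + suc c + d →
  pro^ q (suc s) (shaped π (suc s) (suc a) b (suc c)) ≡ shaped (opposite π) (suc a) b (suc c) d
pro^-shaped-wrap q π s a b c d refl = begin
  promotion q (pro^ q s (level (suc s)))      ≡⟨ cong (λ n → promotion q (pro^ q s (level n))) (+-identityʳ (suc s)) ⟨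
  promotion q (pro^ q s (level (suc s + 0)))  ≡⟨ cong (promotion q) (pro^-shaped-descend q π s 0 (suc a) b (suc c)) ⟩
  promotion q (level 1)                       ≡⟨ promotion-shaped-wrap π a b c d ⟩
  shaped (opposite π) (suc a) b (suc c) d     ∎
  where
  open ≡-Reasoning
  level : ℕ → Lab
  level n = shaped π n (suc a) b (suc c)

shaped-phase : ∀ q x π s a b c d → q ≡ suc a + b + suc c + d →
  Segment q x (shaped π (suc s) (suc a) b (suc c)) (suc s) (phaseSum x π (suc s) (suc a) b (suc c))
              (shaped (opposite π) (suc a) b (suc c) d)
shaped-phase q x π s a b c d q≡ = record
  { lands = pro^-shaped-wrap q π s a b c d q≡
  ; sums  = orbitSum-shaped q x π (suc s) (suc a) b (suc c)
  }

shaped-phase-back : ∀ q x π s a b c d → q ≡ suc a + b + suc c + d →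
  Segment q x (shaped (opposite π) (suc s) (suc a) b (suc c)) (suc s) (phaseSum x (opposite π) (suc s) (suc a) b (suc c))
              (shaped π (suc a) b (suc c) d)
shaped-phase-back q x π s a b c d q≡ =
  subst (Segment q x _ _ _) (cong (λ π′ → shaped π′ (suc a) b (suc c) d) (opposite-involutive π))
        (shaped-phase q x (opposite π) s a b c d q≡)

cycleSum : El → Pattern → (s a b c : ℕ) → ℕ
cycleSum x π s a b c = phaseSum x π s a b c + phaseSum x (opposite π) a b c s
                     + phaseSum x π b c s a + phaseSum x (opposite π) c s a b

gaps-rotate : ∀ s a b c → suc s + suc a + suc b + suc c ≡ suc a + suc b + suc c + suc s
gaps-rotate = solve-∀

-- Four wraps rotate the cyclic gaps once around and restore the pattern.
shaped-cycle : ∀ x π s a b c → let q = suc s + suc a + suc b + suc c ; h = shaped π (suc s) (suc a) (suc b) (suc c) in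
  Segment q x h q (cycleSum x π (suc s) (suc a) (suc b) (suc c)) h
shaped-cycle x π s a b c =
  shaped-phase _ x π s a (suc b) c (suc s) rotated₁
  ⨾ shaped-phase-back _ x π a b (suc c) s (suc a) rotated₂
  ⨾ shaped-phase _ x π b c (suc s) a (suc b) rotated₃
  ⨾ shaped-phase-back _ x π c s (suc a) b (suc c) rotated₄
  where
  q : ℕ
  q = suc s + suc a + suc b + suc c
  rotated₁ : q ≡ suc a + suc b + suc c + suc s
  rotated₁ = gaps-rotate s a b c
  rotated₂ : q ≡ suc b + suc c + suc s + suc a
  rotated₂ = trans rotated₁ (gaps-rotate a b c s)
  rotated₃ : q ≡ suc c + suc s + suc a + suc b
  rotated₃ = trans rotated₂ (gaps-rotate b c s a)
  rotated₄ : q ≡ suc s + suc a + suc b + suc c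
  rotated₄ = trans rotated₃ (gaps-rotate c s a b)

-- The cycle sum and the balance condition

≡-sym-⇔ : ∀ {m n : ℕ} → (m ≡ n) ⇔ (n ≡ m)
≡-sym-⇔ = mk⇔ sym sym

+-cancel-⇔ : ∀ {S P X Y} → S + X ≡ P + Y → (S ≡ P ⇔ X ≡ Y)
+-cancel-⇔ {S} {P} {X} {Y} balance = mk⇔
  (λ { refl → +-cancelˡ-≡ S X Y balance })
  (λ { refl → +-cancelʳ-≡ X S P balance })

≡-cancel-⇔ : ∀ {L R} K {m n} → L ≡ K + m → R ≡ K + n → (L ≡ R ⇔ m ≡ n)
≡-cancel-⇔ K refl refl = mk⇔ (+-cancelˡ-≡ K _ _) (cong (K +_))

OppositeGapsEqual : ℕ → ℕ → ℕ → ℕ → Set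
OppositeGapsEqual a b c d = a ≡ c ⊎ b ≡ d

OppositeGapsEqual-rotate : ∀ {a b c d} → OppositeGapsEqual a b c d ⇔ OppositeGapsEqual b c d a
OppositeGapsEqual-rotate = mk⇔ (λ { (inj₁ a≡c) → inj₂ (sym a≡c) ; (inj₂ b≡d) → inj₁ b≡d })
                               (λ { (inj₁ b≡d) → inj₂ b≡d ; (inj₂ c≡a) → inj₁ (sym c≡a) })

-- (u − w)(G − v) = 0, written without subtraction.
cross-product-⇔ : ∀ u w v G → (u * G + w * v ≡ u * v + w * G) ⇔ (u ≡ w ⊎ v ≡ G)
cross-product-⇔ u w v G = mk⇔ to from
  where
  ordered : ∀ {u w v G} → u ≤ w → u * G + w * v ≡ u * v + w * G → u ≡ w ⊎ v ≡ G
  ordered {u} {_} {v} {G} u≤w eq with m≤n⇒∃[o]m+o≡n u≤w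
  ... | zero  , refl = inj₁ (sym (+-identityʳ u))
  ... | suc k , refl = inj₂ (*-cancelˡ-≡ _ _ (suc k) (+-cancelˡ-≡ (u * G + u * v) _ _ (begin
          u * G + u * v + suc k * v   ≡⟨ solve (u ∷ k ∷ v ∷ G ∷ []) ⟩
          u * G + (u + suc k) * v     ≡⟨ eq ⟩
          u * v + (u + suc k) * G     ≡⟨ solve (u ∷ k ∷ v ∷ G ∷ []) ⟩
          u * G + u * v + suc k * G   ∎)))
    where open ≡-Reasoning
  to : u * G + w * v ≡ u * v + w * G → u ≡ w ⊎ v ≡ G
  to eq with ≤-total u w
  ... | inj₁ u≤w = ordered u≤w eq
  ... | inj₂ w≤u with ordered w≤u (trans (+-comm (w * G) (u * v)) (trans (sym eq) (+-comm (u * G) (w * v))))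
  ...   | inj₁ w≡u = inj₁ (sym w≡u)
  ...   | inj₂ v≡G = inj₂ v≡G
  from : u ≡ w ⊎ v ≡ G → u * G + w * v ≡ u * v + w * G
  from (inj₁ refl) = +-comm (u * G) (u * v)
  from (inj₂ refl) = refl

A-κ : ∀ x h → A (κ x) h ≡ A x h
A-κ x1 h = +-comm (val h x4) (val h x1)
A-κ x2 h = +-comm (val h x3) (val h x2)
A-κ x3 h = +-comm (val h x2) (val h x3)
A-κ x4 h = +-comm (val h x1) (val h x4)

cycleSum-κ : ∀ x π s a b c → cycleSum (κ x) π s a b c ≡ cycleSum x π s a b c
cycleSum-κ x π s a b c =
  cong₂ _+_ (cong₂ _+_ (cong₂ _+_ (phaseSum-κ π s a b c) (phaseSum-κ (opposite π) a b c s)) (phaseSum-κ π b c s a))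
            (phaseSum-κ (opposite π) c s a b)
  where
  phaseSum-κ : ∀ π s a b c → phaseSum (κ x) π s a b c ≡ phaseSum x π s a b c
  phaseSum-κ π s a b c = cong (λ t → s * suc s + s * t) (A-κ x (shaped π 0 a b c))

-- As q (q + 1) = Σ s (s + 1) + Σ s (q − s) over the phase lengths s = u, v, w, G, the cycle sum exceeds
-- q (q + 1) by Σ s (A_x (shaped π 0 …) − (q − s)) = u (v − G) + 0 + w (G − v) + 0 for x1, and by minus that for x3.
cycleSum-x1 : ∀ u v w G →
  cycleSum x1 p2413 u v w G + (u * G + w * v) ≡ suc (u + v + w + G) * (u + v + w + G) + (u * v + w * G)
cycleSum-x1 = polynomial
  where
  polynomial : ∀ u v w G →
    u * suc u + u * (v + (v + w)) + (v * suc v + v * (w + G + u)) + (w * suc w + w * (G + (G + u)))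
      + (G * suc G + G * (u + v + w)) + (u * G + w * v)
    ≡ suc (u + v + w + G) * (u + v + w + G) + (u * v + w * G)
  polynomial = solve-∀

cycleSum-x3 : ∀ u v w G →
  cycleSum x3 p2413 u v w G + (u * v + w * G) ≡ suc (u + v + w + G) * (u + v + w + G) + (u * G + w * v)
cycleSum-x3 = polynomial
  where
  polynomial : ∀ u v w G →
    u * suc u + u * (v + w + G) + (v * suc v + v * (w + (w + G))) + (w * suc w + w * (G + u + v))
      + (G * suc G + G * (u + (u + v))) + (u * v + w * G)
    ≡ suc (u + v + w + G) * (u + v + w + G) + (u * G + w * v)
  polynomial = solve-∀

cycleSum-criterion : ∀ x u v w G →
  (cycleSum x p2413 u v w G ≡ suc (u + v + w + G) * (u + v + w + G)) ⇔ OppositeGapsEqual u v w G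
cycleSum-criterion x1 u v w G = ⇔.trans (+-cancel-⇔ (cycleSum-x1 u v w G)) (cross-product-⇔ u w v G)
cycleSum-criterion x3 u v w G =
  ⇔.trans (+-cancel-⇔ (cycleSum-x3 u v w G)) (⇔.trans (cross-product-⇔ u w G v) (⇔-id _ ⊎-⇔ ≡-sym-⇔))
cycleSum-criterion x4 u v w G rewrite cycleSum-κ x1 p2413 u v w G = cycleSum-criterion x1 u v w G
cycleSum-criterion x2 u v w G rewrite cycleSum-κ x3 p2413 u v w G = cycleSum-criterion x3 u v w G

BalancedSorted : ℕ → (w x y z : ℕ) → Set
BalancedSorted q w x y z = x + y ≡ z + w ⊎ w + q + x ≡ y + z

-- The sorted rearrangement of the labels is unique, so Balanced only depends on it.
Balanced-sorted : ∀ {q a b c d w x y z} → (w ∷ x ∷ y ∷ z ∷ []) ↭ (a ∷ b ∷ c ∷ d ∷ []) →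
  w ≤ x → x ≤ y → y ≤ z →
  Balanced q (lab a b c d) ⇔ BalancedSorted q w x y z
Balanced-sorted {q} {a} {b} {c} {d} {w} {x} {y} {z} sorting w≤x x≤y y≤z =
  mk⇔ to (λ balanced → _ , _ , _ , _ , sorting , w≤x , x≤y , y≤z , balanced)
  where
  to : Balanced q (lab a b c d) → BalancedSorted q w x y z
  to (w′ , x′ , y′ , z′ , sorting′ , w′≤x′ , x′≤y′ , y′≤z′ , balanced)
    with ↗↭↗⇒≋ ≤-totalOrder (w′≤x′ Linked.∷ x′≤y′ Linked.∷ y′≤z′ Linked.∷ Linked.[-])
                            (w≤x Linked.∷ x≤y Linked.∷ y≤z Linked.∷ Linked.[-])
                            (↭⇒↭ₛ (↭-trans sorting′ (↭-sym sorting)))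
  ... | refl Pointwise.∷ refl Pointwise.∷ refl Pointwise.∷ refl Pointwise.∷ Pointwise.[] = balanced

BalancedSorted-gaps : ∀ q s a b c d → q ≡ a + b + c + d →
  BalancedSorted q s (s + a) (s + a + b) (s + a + b + c) ⇔ OppositeGapsEqual a b c d
BalancedSorted-gaps q s a b c d refl = first ⊎-⇔ second
  where
  first : (s + a + (s + a + b) ≡ s + a + b + c + s) ⇔ (a ≡ c)
  first = ≡-cancel-⇔ (s + (s + a + b)) lower upper
    where
    lower : s + a + (s + a + b) ≡ s + (s + a + b) + a
    lower = solve (s ∷ a ∷ b ∷ [])
    upper : s + a + b + c + s ≡ s + (s + a + b) + c
    upper = solve (s ∷ a ∷ b ∷ c ∷ [])
  second : (s + (a + b + c + d) + (s + a) ≡ s + a + b + (s + a + b + c)) ⇔ (b ≡ d)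
  second = ⇔.trans (≡-cancel-⇔ (s + s + a + a + b + c) lower upper) ≡-sym-⇔
    where
    lower : s + (a + b + c + d) + (s + a) ≡ s + s + a + a + b + c + d
    lower = solve (s ∷ a ∷ b ∷ c ∷ d ∷ [])
    upper : s + a + b + (s + a + b + c) ≡ s + s + a + a + b + c + b
    upper = solve (s ∷ a ∷ b ∷ c ∷ [])

Balanced-shaped : ∀ q π s a b c d → q ≡ a + b + c + d → Balanced q (shaped π s a b c) ⇔ OppositeGapsEqual a b c d
Balanced-shaped q π s a b c d q≡ = ⇔.trans (sorted π) (BalancedSorted-gaps q s a b c d q≡)
  where
  sorting₂₄₁₃ : (s ∷ s + a ∷ s + a + b ∷ s + a + b + c ∷ []) ↭ (s + a ∷ s + a + b + c ∷ s ∷ s + a + b ∷ [])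
  sorting₂₄₁₃ = ↭-trans (↭-swap s (s + a) ↭-refl)
                        (↭-prep (s + a) (↭-trans (↭-prep s (↭-swap _ _ ↭-refl)) (↭-swap s _ ↭-refl)))
  sorted : ∀ π → Balanced q (shaped π s a b c) ⇔ BalancedSorted q s (s + a) (s + a + b) (s + a + b + c)
  sorted p1324 = Balanced-sorted (↭-prep s (↭-swap (s + a) (s + a + b) ↭-refl)) (m≤m+n s a) (m≤m+n _ b) (m≤m+n _ c)
  sorted p2413 = Balanced-sorted sorting₂₄₁₃ (m≤m+n s a) (m≤m+n _ b) (m≤m+n _ c)

data BalancedShape (q : ℕ) : Lab → Set where
  balancedShape : ∀ π s a b c d → q ≡ suc a + suc b + suc c + suc d →
    OppositeGapsEqual (suc a) (suc b) (suc c) (suc d) → BalancedShape q (shaped π (suc s) (suc a) (suc b) (suc c))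

promotion-BalancedShape : ∀ {q h} → BalancedShape q h → BalancedShape q (promotion q h)
promotion-BalancedShape {q} (balancedShape π (suc s) a b c d q≡ opposite-equal) =
  subst (BalancedShape q) (sym (promotion-shaped-suc q π s _ _ _)) (balancedShape π s a b c d q≡ opposite-equal)
promotion-BalancedShape (balancedShape π zero a b c d refl opposite-equal) =
  subst (BalancedShape _) (sym (promotion-shaped-wrap π a (suc b) c (suc d)))
        (balancedShape (opposite π) a b c d a (gaps-rotate a b c d) (Equivalence.to OppositeGapsEqual-rotate opposite-equal))

pro^-BalancedShape : ∀ {q h} → BalancedShape q h → ∀ k → BalancedShape q (pro^ q k h)
pro^-BalancedShape shape zero    = shape
pro^-BalancedShape shape (suc k) = promotion-BalancedShape (pro^-BalancedShape shape k)

BalancedShape⇒Balanced : ∀ {q h} → BalancedShape q h → Balanced q h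
BalancedShape⇒Balanced {q} (balancedShape π s a b c d q≡ opposite-equal) =
  Equivalence.from (Balanced-shaped q π (suc s) (suc a) (suc b) (suc c) (suc d) q≡) opposite-equal

-- Orbits through a 1324 labeling

-- The orbit of f passes a labeling right after a wrap, where the top label is q.
data WrapPoint : ℕ → Lab → Set where
  wrapPoint : ∀ {f} j u v w G → pro^ (suc u + suc v + suc w + suc G) j f ≡ shaped p2413 (suc u) (suc v) (suc w) (suc G) →
              WrapPoint (suc u + suc v + suc w + suc G) f

WrapPoint-pro^ : ∀ {q f} k → WrapPoint q (pro^ q k f) → WrapPoint q f
WrapPoint-pro^ {f = f} k (wrapPoint j u v w G reaches) = wrapPoint (j + k) u v w G (trans (pro^-+ _ j k f) reaches)

<⇒∃-offset : ∀ {m n} → m < n → ∃ λ k → n ≡ m + suc k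
<⇒∃-offset {m} m<n with k , m+1+k≡n ← m≤n⇒∃[o]m+o≡n m<n = k , trans (sym m+1+k≡n) (sym (+-suc m k))

Has1324⇒WrapPoint : ∀ {q h} → Bounded q h → Has1324 h → WrapPoint q h
Has1324⇒WrapPoint {h = lab zero b c d} bounded _ with () ← proj₁ (bounded x1)
Has1324⇒WrapPoint {h = lab (suc a) b c d} bounded (a<c , c<b , b<d)
  with u , refl ← <⇒∃-offset a<c | v , refl ← <⇒∃-offset c<b | w , refl ← <⇒∃-offset b<d
     | z , refl ← m≤n⇒∃[o]m+o≡n (proj₂ (bounded x4)) =
  subst (λ q → WrapPoint q (shaped p1324 (suc a) (suc u) (suc v) (suc w))) size
        (wrapPoint (suc a) u v w (a + z) (pro^-shaped-wrap _ p1324 a u (suc v) w (suc (a + z)) refl))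
  where
  size : suc u + suc v + suc w + suc (a + z) ≡ suc a + suc u + suc v + suc w + z
  size = solve (a ∷ u ∷ v ∷ w ∷ z ∷ [])

OrbitBalanced-wrapPoint : ∀ {f j r u v w G} →
  let q = suc u + suc v + suc w + suc G ; h₀ = shaped p2413 (suc u) (suc v) (suc w) (suc G) in
  pro^ q j f ≡ h₀ → pro^ q r h₀ ≡ f → OrbitBalanced q f ⇔ OppositeGapsEqual (suc u) (suc v) (suc w) (suc G)
OrbitBalanced-wrapPoint {f} {j} {r} {u} {v} {w} {G} reaches returns = ⇔.trans (mk⇔ to from) (⇔.sym OppositeGapsEqual-rotate)
  where
  q : ℕ
  q = suc u + suc v + suc w + suc G
  h₀ : Lab
  h₀ = shaped p2413 (suc u) (suc v) (suc w) (suc G)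
  h₀-balanced : Balanced q h₀ ⇔ OppositeGapsEqual (suc v) (suc w) (suc G) (suc u)
  h₀-balanced = Balanced-shaped q p2413 (suc u) (suc v) (suc w) (suc G) (suc u) (gaps-rotate u v w G)
  to : OrbitBalanced q f → OppositeGapsEqual (suc v) (suc w) (suc G) (suc u)
  to balanced = Equivalence.to h₀-balanced (subst (Balanced q) reaches (balanced j))
  from : OppositeGapsEqual (suc v) (suc w) (suc G) (suc u) → OrbitBalanced q f
  from opposite-equal k = subst (Balanced q) (trans (pro^-+ q k r h₀) (cong (pro^ q k) returns))
    (BalancedShape⇒Balanced (pro^-BalancedShape (balancedShape p2413 u v w G u (gaps-rotate u v w G) opposite-equal) (k + r)))

wrapPoint-criterion : ∀ {q f p} x → OrbitSize q f p → WrapPoint q f → (orbitSum q x p f ≡ suc q * p) ⇔ OrbitBalanced q f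
wrapPoint-criterion {f = f} {p = suc p} x size@(_ , period , _) (wrapPoint j u v w G reaches) = begin
  (orbitSum q x (suc p) f ≡ suc q * suc p)                          ≈⟨ sumTo-periodic-average (suc q) (A-periodic q x period) multiple ⟩
  (orbitSum q x q f ≡ suc q * q)                                    ≡⟨ cong (_≡ suc q * q) cycle-sum ⟩
  (cycleSum x p2413 (suc u) (suc v) (suc w) (suc G) ≡ suc q * q)    ≈⟨ cycleSum-criterion x (suc u) (suc v) (suc w) (suc G) ⟩
  OppositeGapsEqual (suc u) (suc v) (suc w) (suc G)                 ≈⟨ OrbitBalanced-wrapPoint reaches returns ⟨
  OrbitBalanced q f                                                 ∎
  where
  open ⇔-Reasoning
  q : ℕ
  q = suc u + suc v + suc w + suc G
  h₀ : Lab
  h₀ = shaped p2413 (suc u) (suc v) (suc w) (suc G)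
  cycle : Segment q x h₀ q (cycleSum x p2413 (suc u) (suc v) (suc w) (suc G)) h₀
  cycle = shaped-cycle x p2413 u v w G
  returns : pro^ q (j * p) h₀ ≡ f
  returns = subst (λ h → pro^ q (j * p) h ≡ f) reaches (pro^-return q period j)
  periodic : pro^ q q f ≡ f
  periodic = pro^-fixed-along q (Segment.lands cycle) returns
  multiple : ∃ λ m → q ≡ suc m * suc p
  multiple with OrbitSize-∣ q size periodic
  ... | divides (suc m) q≡ = m , q≡
  cycle-sum : orbitSum q x q f ≡ cycleSum x p2413 (suc u) (suc v) (suc w) (suc G)
  cycle-sum = trans (sym (orbitSum-rotate q x j periodic)) (trans (cong (orbitSum q x q) reaches) (Segment.sums cycle))

proposition7p10 : (q : ℕ) (f : Lab) → Inc q f → (x : El) (p : ℕ) → OrbitSize q f p →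
    OrbitContains1324 q f →
    ((sumTo p (λ k → A x (pro^ q k f)) ≡ suc q * p) ⇔ OrbitBalanced q f)
proposition7p10 q f inc x p size (k , has1324) =
  wrapPoint-criterion x size (WrapPoint-pro^ k (Has1324⇒WrapPoint (pro^-bounded (proj₁ inc) k) has1324))
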